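{- Let $p$ be an odd prime and $i\in\{1,2\}$, and suppose $Q_i^p$ is non-empty. Then $$|C_i[p]|\le \min\{\operatorname{ord}_{A_i^q}(p) : q\in Q_i^p\},$$ and moreover $\min\{\operatorname{ord}_{A_i^q}(p) : q\in Q_i^p\}<p-1$.
   Context: Cunningham chain: for an odd prime $p$ and $i\in\{1,2\}$, set $a_n=2^{n-1}p+(-1)^{i+1}(2^{n-1}-1)$ for $n\ge1$ (so $a_1=p$ and $a_{n+1}=2a_n+(-1)^{i+1}$), let $k$ be the largest integer such that $a_1,\dots,a_k$ are all prime, and let $C_i[p]=\{a_1,\dots,a_k\}$ (so $|C_i[p]|=k$). Rogue sets: for an odd prime $q$, $A_i^q=(\mathbb{Z}/q\mathbb{Z})^\times\setminus\{(-1)^i \bmod q\}$. For $g\in A_i^q$ define $u_1=g$, $u_n=2u_{n-1}+(-1)^{i+1}$ in $\mathbb{Z}/q\mathbb{Z}$, $g_k^i=\min(\{n: u_n=0\}\cup\{\infty\})$, and the rogue sequence $\langle g\rangle_i^q=(u_n)_{1\le n<g_k^i}$. A rogue loop is a periodic rogue sequence (never reaching $0$). $q$ is a rogue prime if for some $i\in\{1,2\}$ some $\langle g\rangle_i^q$ with $g\in A_i^q$ is a rogue loop; otherwise $q$ is non-rogue (equivalently $2$ is a primitive root mod $q$). For non-rogue $q$, the rogue sequence $\langle(-1)^{i+1}\rangle_i^q=(u_1,\dots,u_{q-2})$ has underlying set exactly $A_i^q$ with distinct terms; for $x\in A_i^q$ let $k_x$ be the index with $u_{k_x}=x$, and define $\operatorname{ord}_{A_i^q}(x)=q-1-k_x$;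 for an integer $n$ with $n \bmod q\in A_i^q$, $\operatorname{ord}_{A_i^q}(n)$ means $\operatorname{ord}_{A_i^q}(n\bmod q)$. For $n\in\mathbb{N}$, $Q_i^n$ is the set of non-rogue odd primes $q<n$ such that $n\not\equiv(-1)^i \pmod q$ (i.e. such that $n \bmod q\in A_i^q$). -}

module Defs where

open import Data.Nat using (ℕ; zero; suc; _+_; _*_; _∸_; _<_; _≤_; _%_)
open import Data.Nat.Primality using (Prime)
open import Data.Product using (Σ; _×_; ∃)
open import Relation.Binary.PropositionalEquality using (_≡_)
open import Relation.Nullary using (¬_)
open import Data.Bool using (Bool; true; false; if_then_else_)
open import Data.Nat using (_≡ᵇ_)

data Idx : Set where
  one two : Idx

-- reduction modulo q (q = 0 is never used; it just returns x)
modN : ℕ → ℕ → ℕ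
modN x zero    = x
modN x (suc q) = x % suc q

-- Cunningham chains
-- chain i p j  =  a_{j+1}   (so chain i p 0 = a_1 = p),
-- a_{n+1} = 2 a_n + 1 (i = 1),  a_{n+1} = 2 a_n − 1 (i = 2)
-- (for i = 2 and p ≥ 3 the truncated subtraction never truncates)
chain : Idx → ℕ → ℕ → ℕ
chain one p zero    = p
chain one p (suc j) = 2 * chain one p j + 1
chain two p zero    = p
chain two p (suc j) = 2 * chain two p j ∸ 1

ChainPrimeUpTo : Idx → ℕ → ℕ → Set
ChainPrimeUpTo i p k = ∀ j → j < k → Prime (chain i p j)

-- Residues mod q are represented by naturals in {0,…,q-1}.

-- (-1)^i mod q
signI : Idx → ℕ → ℕ
signI one q = q ∸ 1
signI two q = modN 1 q

signI+1 : Idx → ℕ → ℕ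
signI+1 one q = modN 1 q
signI+1 two q = q ∸ 1

InA : Idx → ℕ → ℕ → Set
InA i q x = 1 ≤ x × x < q × ¬ (x ≡ signI i q)

step : Idx → ℕ → ℕ → ℕ
step i q x = modN (2 * x + signI+1 i q) q

-- useq i q g n = u_{n+1} of the rogue sequence started at u_1 = g
useq : Idx → ℕ → ℕ → ℕ → ℕ
useq i q g zero    = g
useq i q g (suc n) = step i q (useq i q g n)

Rogue : ℕ → Set
Rogue q = Σ Idx λ i → Σ ℕ λ g → InA i q g × (∀ n → ¬ (useq i q g n ≡ 0))

InQ : Idx → ℕ → ℕ → Set
InQ i n q = Prime q × ¬ (q ≡ 2) × q < n × ¬ Rogue q × ¬ (modN n q ≡ signI i q)

-- ord_{A_i^q}(x) = q − 1 − k_x, where k_x is the index (1 ≤ k_x ≤ q−2)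
-- with u_{k_x} = x in the sequence ⟨(-1)^(i+1)⟩_i^q.

-- search indices k = m+1, …, m+fuel (1-based) for u_k = x
searchIdx : Idx → ℕ → ℕ → ℕ → ℕ → ℕ
searchIdx i q x m zero       = 0
searchIdx i q x m (suc fuel) =
  if useq i q (signI+1 i q) m ≡ᵇ x then suc m else searchIdx i q x (suc m) fuel

kIdx : Idx → ℕ → ℕ → ℕ
kIdx i q x = searchIdx i q x 0 (q ∸ 2)

ordA : Idx → ℕ → ℕ → ℕ
ordA i q n = q ∸ 1 ∸ kIdx i q (modN n q)

-- Reduced modulo a non-rogue odd prime q < p, the chain a₁, a₂, … follows the
-- rogue sequence started at x = p mod q ∈ Aᵢ^q, which must reach 0; the first
-- term aⱼ with q ∣ aⱼ is composite since aⱼ ≥ p > q, so the chain has length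
-- at most the first zero index of that sequence. Since u ↦ 2u ± 1 is injective
-- modulo q and fixes (-1)^i, the terms before the first zero are distinct and
-- avoid 0 and (-1)^i, so there are at most q − 2 of them. If x = u_k in the
-- sequence started at (-1)^(i+1), the sequence from x is a tail of that one and
-- reaches 0 within q − 1 − k = ord(x) steps.
-- Non-rogueness only says the sequence does not avoid 0 forever, so the zero is
-- found under a double negation, which is harmless as the conclusion is
-- decidable.
module Submission where

open import Defs
open import Data.Nat using (ℕ; _<_; _≤_; _∸_)
open import Data.Nat.Primality using (Prime)
open import Data.Product using (Σ; _×_)
open import Relation.Binary.PropositionalEquality using (_≡_)
open import Relation.Nullary using (¬_)

open import Data.Bool using (true; false; T)
open import Data.Fin as Fin using (Fin; toℕ; fromℕ<)
open import Data.Fin.Properties using (injective⇒≤; toℕ<n; toℕ-injective; fromℕ<-injective)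
open import Data.Nat using (zero; suc; _+_; _*_; _%_; _≡ᵇ_; _/_; _≤?_; _≟_; z≤n; s≤s; NonZero; NonTrivial; nonTrivial⇒n>1)
open import Data.Nat.Divisibility using (_∣_; divides; >⇒∤; m%n≡0⇒n∣m)
open import Data.Nat.DivMod
open import Data.Nat.Primality using (composite; composite⇒¬prime; euclidsLemma; ¬prime[0]; ¬prime[1]; prime⇒nonTrivial)
open import Data.Nat.Properties
open import Data.Product using (∃; _,_; proj₁)
open import Data.Sum using (inj₁; inj₂)
open import Data.Unit using (tt)
open import Function.Definitions using (Injective)
open import Level using (0ℓ)
open import Relation.Binary.Definitions using (tri<; tri≈; tri>)
open import Relation.Binary.PropositionalEquality using (_≢_; refl; sym; trans; cong; cong₂; subst; module ≡-Reasoning)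
open import Relation.Nullary using (yes; no; contradiction)
open import Relation.Nullary.Decidable using (decidable-stable)
open import Relation.Nullary.Negation using (¬¬-map)
open import Relation.Unary using (Pred; Decidable)

Least : ∀ {ℓ} → Pred ℕ ℓ → Pred ℕ ℓ
Least P z = P z × (∀ w → w < z → ¬ P w)

least-witness : ∀ {ℓ} {P : Pred ℕ ℓ} → Decidable P → ∀ n → P n → ∃ (Least P)
least-witness {P = P} P? n Pn = search 0 n (λ _ ()) (subst P (sym (+-identityʳ n)) Pn)
  where
  search : ∀ m fuel → (∀ w → w < m → ¬ P w) → P (fuel + m) → ∃ (Least P)
  search m zero    below Pm = m , Pm , below
  search m (suc fuel) below Pn+m with P? m
  ... | yes Pm = m , Pm , below
  ... | no ¬Pm = search (suc m) fuel below′ (subst P (sym (+-suc fuel m)) Pn+m)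
    where
    below′ : ∀ w → w < suc m → ¬ P w
    below′ w w<1+m with m<1+n⇒m<n∨m≡n w<1+m
    ... | inj₁ w<m  = below w w<m
    ... | inj₂ refl = ¬Pm

∣∧<⇒≡0 : ∀ {d n} → d ∣ n → n < d → n ≡ 0
∣∧<⇒≡0 {n = zero}  _   _   = refl
∣∧<⇒≡0 {n = suc n} d∣n n<d = contradiction d∣n (>⇒∤ n<d)

module _ {d : ℕ} .{{_ : NonZero d}} where

  %≡%⇒∣∸ : ∀ {a b} → b ≤ a → a % d ≡ b % d → d ∣ a ∸ b
  %≡%⇒∣∸ {a} {b} b≤a eq = divides (a / d ∸ b / d) (begin
    a ∸ b                                   ≡⟨ cong₂ _∸_ (m≡m%n+[m/n]*n a d) (m≡m%n+[m/n]*n b d) ⟩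
    (a % d + a / d * d) ∸ (b % d + b / d * d) ≡⟨ cong (λ t → (a % d + a / d * d) ∸ (t + b / d * d)) (sym eq) ⟩
    (a % d + a / d * d) ∸ (a % d + b / d * d) ≡⟨ [m+n]∸[m+o]≡n∸o (a % d) _ _ ⟩
    a / d * d ∸ b / d * d                   ≡⟨ sym (*-distribʳ-∸ d (a / d) (b / d)) ⟩
    (a / d ∸ b / d) * d                     ∎)
    where open ≡-Reasoning

  %-cong-+ : ∀ a a′ b b′ → a % d ≡ a′ % d → b % d ≡ b′ % d → (a + b) % d ≡ (a′ + b′) % d
  %-cong-+ a a′ b b′ a≡a′ b≡b′ = begin
    (a + b) % d             ≡⟨ %-distribˡ-+ a b d ⟩
    (a % d + b % d) % d     ≡⟨ cong₂ (λ u v → (u + v) % d) a≡a′ b≡b′ ⟩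
    (a′ % d + b′ % d) % d   ≡⟨ sym (%-distribˡ-+ a′ b′ d) ⟩
    (a′ + b′) % d           ∎
    where open ≡-Reasoning

  %-cong-* : ∀ c a a′ → a % d ≡ a′ % d → (c * a) % d ≡ (c * a′) % d
  %-cong-* c a a′ a≡a′ = begin
    (c * a) % d             ≡⟨ %-distribˡ-* c a d ⟩
    (c % d * (a % d)) % d   ≡⟨ cong (λ u → (c % d * u) % d) a≡a′ ⟩
    (c % d * (a′ % d)) % d  ≡⟨ sym (%-distribˡ-* c a′ d) ⟩
    (c * a′) % d            ∎
    where open ≡-Reasoning

module _ {q : ℕ} .{{_ : NonZero q}} (q-prime : Prime q) {c : ℕ} (q∤c : ¬ q ∣ c) (b : ℕ) where

  private
    cancel-≥ : ∀ {x y} → x < q → y ≤ x → (c * x + b) % q ≡ (c * y + b) % q → x ≡ y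
    cancel-≥ {x} {y} x<q y≤x eq with euclidsLemma c (x ∸ y) q-prime q∣c[x∸y]
      where
      q∣c[x∸y] : q ∣ c * (x ∸ y)
      q∣c[x∸y] = subst (q ∣_) (begin
        (c * x + b) ∸ (c * y + b) ≡⟨ cong₂ _∸_ (+-comm (c * x) b) (+-comm (c * y) b) ⟩
        (b + c * x) ∸ (b + c * y) ≡⟨ [m+n]∸[m+o]≡n∸o b (c * x) (c * y) ⟩
        c * x ∸ c * y             ≡⟨ sym (*-distribˡ-∸ c x y) ⟩
        c * (x ∸ y)               ∎)
        (%≡%⇒∣∸ (+-monoˡ-≤ b (*-monoʳ-≤ c y≤x)) eq)
        where open ≡-Reasoning
    ... | inj₁ q∣c   = contradiction q∣c q∤c
    ... | inj₂ q∣x∸y = ≤-antisym (m∸n≡0⇒m≤n (∣∧<⇒≡0 q∣x∸y (≤-<-trans (m∸n≤m x y) x<q))) y≤x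

  *-+-%-injective : ∀ {x y} → x < q → y < q → (c * x + b) % q ≡ (c * y + b) % q → x ≡ y
  *-+-%-injective {x} {y} x<q y<q eq with ≤-total y x
  ... | inj₁ y≤x = cancel-≥ x<q y≤x eq
  ... | inj₂ x≤y = sym (cancel-≥ y<q x≤y (sym eq))

chain-≥ : ∀ i {p} → 1 ≤ p → ∀ j → p ≤ chain i p j
chain-≥ one 1≤p zero    = ≤-refl
chain-≥ two 1≤p zero    = ≤-refl
chain-≥ one 1≤p (suc j) = ≤-trans (chain-≥ one 1≤p j) (≤-trans (m≤m+n _ _) (m≤m+n _ 1))
chain-≥ two 1≤p (suc j) = ≤-trans (chain-≥ two 1≤p j) (≤-2*∸1 (≤-trans 1≤p (chain-≥ two 1≤p j)))
  where
  ≤-2*∸1 : ∀ {n} → 1 ≤ n → n ≤ 2 * n ∸ 1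
  ≤-2*∸1 {suc n} _ = ≤-trans (m≤n+m (suc n) n) (+-monoʳ-≤ n (m≤m+n (suc n) 0))

chain-% : ∀ i Q {p} → 1 ≤ p → ∀ j → chain i p j % suc Q ≡ useq i (suc Q) (p % suc Q) j
chain-% one Q 1≤p zero = refl
chain-% two Q 1≤p zero = refl
chain-% one Q {p} 1≤p (suc j) = trans
  (%-cong-+ (2 * c) (2 * (c % suc Q)) 1 (1 % suc Q)
    (%-cong-* 2 c (c % suc Q) (sym (m%n%n≡m%n c (suc Q)))) (sym (m%n%n≡m%n 1 (suc Q))))
  (cong (λ u → (2 * u + 1 % suc Q) % suc Q) (chain-% one Q 1≤p j))
  where c = chain one p j
chain-% two Q {p} 1≤p (suc j) = trans
  (trans (2*∸1-% (≤-trans 1≤p (chain-≥ two 1≤p j)))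
    (%-cong-+ (2 * c) (2 * (c % suc Q)) Q Q (%-cong-* 2 c (c % suc Q) (sym (m%n%n≡m%n c (suc Q)))) refl))
  (cong (λ u → (2 * u + Q) % suc Q) (chain-% two Q 1≤p j))
  where
  c = chain two p j
  2*∸1-% : ∀ {n} → 1 ≤ n → (2 * n ∸ 1) % suc Q ≡ (2 * n + Q) % suc Q
  2*∸1-% {suc n} _ = trans (sym ([m+n]%n≡m%n (2 * suc n ∸ 1) (suc Q))) (cong (_% suc Q) (+-suc (2 * suc n ∸ 1) Q))

chainPrimeUpTo-≤-divisorIndex : ∀ {i p q k j} .{{_ : NonTrivial q}} → q < p →
  ChainPrimeUpTo i p k → q ∣ chain i p j → k ≤ j
chainPrimeUpTo-≤-divisorIndex {i} {p} {q} {k} {j} q<p primes q∣aⱼ with k ≤? j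
... | yes k≤j = k≤j
... | no  k≰j = contradiction (primes j (≰⇒> k≰j)) (composite⇒¬prime (composite q<aⱼ q∣aⱼ))
  where
  q<aⱼ : q < chain i p j
  q<aⱼ = <-≤-trans q<p (chain-≥ i (≤-trans (s≤s z≤n) q<p) j)

signI-< : ∀ i r → signI i (3 + r) < 3 + r
signI-< one r = ≤-refl
signI-< two r = s≤s (s≤s z≤n)

signI+1∈A : ∀ i r → InA i (3 + r) (signI+1 i (3 + r))
signI+1∈A one r = s≤s z≤n , s≤s (s≤s z≤n) , λ ()
signI+1∈A two r = s≤s z≤n , ≤-refl , λ ()

step-signI : ∀ i r → step i (3 + r) (signI i (3 + r)) ≡ signI i (3 + r)
step-signI one r = begin
  (2 * (2 + r) + 1) % (3 + r)       ≡⟨ cong (_% (3 + r)) (+-assoc (2 + r) (2 + r + 0) 1) ⟩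
  (2 + r + (2 + r + 0 + 1)) % (3 + r) ≡⟨ cong (λ t → (2 + r + t) % (3 + r)) 2+r+0+1≡3+r ⟩
  (2 + r + (3 + r)) % (3 + r)       ≡⟨ [m+n]%n≡m%n (2 + r) (3 + r) ⟩
  (2 + r) % (3 + r)                 ≡⟨ m<n⇒m%n≡m ≤-refl ⟩
  2 + r                             ∎
  where
  open ≡-Reasoning
  2+r+0+1≡3+r : 2 + r + 0 + 1 ≡ 3 + r
  2+r+0+1≡3+r = trans (cong (_+ 1) (+-identityʳ (2 + r))) (+-comm (2 + r) 1)
step-signI two r = [m+n]%n≡m%n 1 (3 + r)

step-0 : ∀ i r → step i (3 + r) 0 ≡ signI+1 i (3 + r)
step-0 one r = m%n%n≡m%n 1 (3 + r)
step-0 two r = m<n⇒m%n≡m ≤-refl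

module OddPrime (i : Idx) (r : ℕ) (q-prime : Prime (3 + r)) where

  q : ℕ
  q = 3 + r

  σ s : ℕ
  σ = signI i q
  s = signI+1 i q

  orbit : ℕ → ℕ → ℕ
  orbit = useq i q

  ZeroAt : ℕ → Pred ℕ 0ℓ
  ZeroAt g n = orbit g n ≡ 0

  step-injective : ∀ {x y} → x < q → y < q → step i q x ≡ step i q y → x ≡ y
  step-injective = *-+-%-injective q-prime (>⇒∤ (s≤s (s≤s (s≤s z≤n)))) s

  orbit-< : ∀ {g} → g < q → ∀ n → orbit g n < q
  orbit-< g<q zero        = g<q
  orbit-< {g} g<q (suc n) = m%n<n (2 * orbit g n + s) q

  orbit-+ : ∀ g a b → orbit g (b + a) ≡ orbit (orbit g a) b
  orbit-+ g a zero    = refl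
  orbit-+ g a (suc b) = cong (step i q) (orbit-+ g a b)

  orbit-≢σ : ∀ {g} → g < q → g ≢ σ → ∀ n → orbit g n ≢ σ
  orbit-≢σ g<q g≢σ zero    = g≢σ
  orbit-≢σ g<q g≢σ (suc n) uₙ₊₁≡σ =
    orbit-≢σ g<q g≢σ n (step-injective (orbit-< g<q n) (signI-< i r) (trans uₙ₊₁≡σ (sym (step-signI i r))))

  orbit-periodic : ∀ {g d} → orbit g d ≡ g → ∀ t → orbit g (t + d) ≡ orbit g t
  orbit-periodic {g} {d} uᵈ≡g t = trans (orbit-+ g d t) (cong (λ h → orbit h t) uᵈ≡g)

  orbit-returns : ∀ {g} → g < q → ∀ d a → orbit g a ≡ orbit g (d + a) → orbit g d ≡ g
  orbit-returns g<q d zero    eq = sym (trans eq (cong (orbit _) (+-identityʳ d)))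
  orbit-returns g<q d (suc a) eq = orbit-returns g<q d a
    (step-injective (orbit-< g<q a) (orbit-< g<q (d + a)) (trans eq (cong (orbit _) (+-suc d a))))

  -- a repetition before the first zero would make the orbit periodic with a
  -- shorter period, producing an earlier zero
  orbit-<-firstZero-injective : ∀ {g z a b} → g < q → Least (ZeroAt g) z →
    a < b → b ≤ z → orbit g a ≢ orbit g b
  orbit-<-firstZero-injective {g} {z} {a} {b} g<q (uᶻ≡0 , before) a<b b≤z uᵃ≡uᵇ =
    before (z ∸ d) (∸-monoʳ-< (m<n⇒0<n∸m a<b) d≤z) uᶻ⁻ᵈ≡0
    where
    d = b ∸ a
    d≤z : d ≤ z
    d≤z = ≤-trans (m∸n≤m b a) b≤z
    returns : orbit g d ≡ g
    returns = orbit-returns g<q d a (trans uᵃ≡uᵇ (cong (orbit g) (sym (m∸n+n≡m (<⇒≤ a<b)))))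
    uᶻ⁻ᵈ≡0 : orbit g (z ∸ d) ≡ 0
    uᶻ⁻ᵈ≡0 = trans (sym (orbit-periodic returns (z ∸ d))) (trans (cong (orbit g) (m∸n+n≡m d≤z)) uᶻ≡0)

  firstZero-≤ : ∀ {g z} → InA i q g → Least (ZeroAt g) z → z ≤ q ∸ 2
  firstZero-≤ {g} {z} (_ , g<q , g≢σ) first = ≤-pred (≤-pred (injective⇒≤ values-injective))
    where
    value : ℕ → Fin q
    value n = fromℕ< (orbit-< g<q n)
    values : Fin (2 + z) → Fin q
    values Fin.zero    = fromℕ< (signI-< i r)
    values (Fin.suc t) = value (toℕ t)

    orbit-injective : ∀ {a b} → a ≤ z → b ≤ z → orbit g a ≡ orbit g b → a ≡ b
    orbit-injective {a} {b} a≤z b≤z eq with <-cmp a b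
    ... | tri< a<b _ _ = contradiction eq (orbit-<-firstZero-injective g<q first a<b b≤z)
    ... | tri≈ _ a≡b _ = a≡b
    ... | tri> _ _ b<a = contradiction (sym eq) (orbit-<-firstZero-injective g<q first b<a a≤z)

    values-injective : Injective _≡_ _≡_ values
    values-injective {Fin.zero}  {Fin.zero}  _  = refl
    values-injective {Fin.zero}  {Fin.suc b} eq =
      contradiction (sym (fromℕ<-injective _ _ _ _ eq)) (orbit-≢σ g<q g≢σ (toℕ b))
    values-injective {Fin.suc a} {Fin.zero}  eq =
      contradiction (fromℕ<-injective _ _ _ _ eq) (orbit-≢σ g<q g≢σ (toℕ a))
    values-injective {Fin.suc a} {Fin.suc b} eq = cong Fin.suc (toℕ-injective
      (orbit-injective (≤-pred (toℕ<n a)) (≤-pred (toℕ<n b)) (fromℕ<-injective _ _ _ _ eq)))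

  nonRogue⇒¬¬firstZero : ¬ Rogue q → ∀ {g} → InA i q g → ¬ ¬ ∃ (Least (ZeroAt g))
  nonRogue⇒¬¬firstZero nonRogue {g} g∈A noZero =
    nonRogue (i , g , g∈A , λ n uⁿ≡0 → noZero (least-witness (λ n → orbit g n ≟ 0) n uⁿ≡0))

  searchIdx-found : ∀ x m fuel n → searchIdx i q x m fuel ≡ suc n →
    orbit s n ≡ x × (∀ t → m ≤ t → t < n → orbit s t ≢ x)
  searchIdx-found x m (suc fuel) n found with orbit s m ≡ᵇ x in hit
  ... | true  rewrite suc-injective (sym found) =
    ≡ᵇ⇒≡ _ _ (subst T (sym hit) tt) , λ t m≤t t<m → contradiction m≤t (<⇒≱ t<m)
  ... | false with searchIdx-found x (suc m) fuel n found
  ...   | uⁿ≡x , later = uⁿ≡x , earlier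
    where
    earlier : ∀ t → m ≤ t → t < n → orbit s t ≢ x
    earlier t m≤t t<n with m ≟ t
    ... | yes refl = λ uᵐ≡x → subst T hit (≡⇒≡ᵇ _ _ uᵐ≡x)
    ... | no  m≢t  = later t (≤∧≢⇒< m≤t m≢t) t<n

  -- the orbit of s restarts after its first zero, since step 0 ≡ s
  firstOccurrence-<-firstZero : ∀ {x m z} → x ≢ 0 → orbit s m ≡ x → (∀ t → t < m → orbit s t ≢ x) →
    Least (ZeroAt s) z → m < z
  firstOccurrence-<-firstZero {x} {m} {z} x≢0 uᵐ≡x earlier (uᶻ≡0 , _) with <-cmp m z
  ... | tri< m<z _ _ = m<z
  ... | tri≈ _ refl _ = contradiction (trans (sym uᵐ≡x) uᶻ≡0) x≢0
  ... | tri> _ _ z<m = contradiction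
    (trans (sym (orbit-periodic (trans (cong (step i q) uᶻ≡0) (step-0 i r)) (m ∸ suc z)))
           (trans (cong (orbit s) (m∸n+n≡m z<m)) uᵐ≡x))
    (earlier (m ∸ suc z) (∸-monoʳ-< (s≤s z≤n) z<m))

  zero-within-ordA : ¬ Rogue q → ∀ {x} → InA i q x →
    ¬ ¬ ∃ λ z → ZeroAt x z × z ≤ q ∸ 1 ∸ kIdx i q x
  zero-within-ordA nonRogue {x} x∈A@(1≤x , _) with kIdx i q x in k≡
  ... | zero = ¬¬-map (λ (z , first) → z , proj₁ first , m≤n⇒m≤1+n (firstZero-≤ x∈A first))
                      (nonRogue⇒¬¬firstZero nonRogue x∈A)
  ... | suc m with searchIdx-found x 0 (q ∸ 2) m k≡
  ...   | uᵐ≡x , earlier = ¬¬-map from-s (nonRogue⇒¬¬firstZero nonRogue (signI+1∈A i r))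
    where
    from-s : ∃ (Least (ZeroAt s)) → ∃ λ z → ZeroAt x z × z ≤ q ∸ 2 ∸ m
    from-s (z , first@(uᶻ≡0 , _)) = z ∸ m , zero-from-x , ∸-monoˡ-≤ m (firstZero-≤ (signI+1∈A i r) first)
      where
      m<z : m < z
      m<z = firstOccurrence-<-firstZero (>⇒≢ 1≤x) uᵐ≡x (λ t → earlier t z≤n) first
      zero-from-x : orbit x (z ∸ m) ≡ 0
      zero-from-x = begin
        orbit x (z ∸ m)           ≡⟨ cong (λ h → orbit h (z ∸ m)) (sym uᵐ≡x) ⟩
        orbit (orbit s m) (z ∸ m) ≡⟨ sym (orbit-+ s m (z ∸ m)) ⟩
        orbit s (z ∸ m + m)       ≡⟨ cong (orbit s) (m∸n+n≡m (<⇒≤ m<z)) ⟩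
        orbit s z                 ≡⟨ uᶻ≡0 ⟩
        0                         ∎
        where open ≡-Reasoning

  chainLength-≤-ordA : ∀ {p} → Prime p → q < p → ¬ Rogue q → p % q ≢ σ →
    ∀ k → ChainPrimeUpTo i p k → k ≤ ordA i q p
  chainLength-≤-ordA {p} p-prime q<p nonRogue x≢σ k primes =
    decidable-stable (k ≤? ordA i q p) (¬¬-map bound (zero-within-ordA nonRogue x∈A))
    where
    1≤p : 1 ≤ p
    1≤p = ≤-trans (s≤s z≤n) q<p
    x≢0 : p % q ≢ 0
    x≢0 x≡0 = composite⇒¬prime (composite q<p (m%n≡0⇒n∣m p q x≡0)) p-prime
    x∈A : InA i q (p % q)
    x∈A = n≢0⇒n>0 x≢0 , m%n<n p q , x≢σ
    bound : (∃ λ z → ZeroAt (p % q) z × z ≤ q ∸ 1 ∸ kIdx i q (p % q)) → k ≤ ordA i q p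
    bound (z , uᶻ≡0 , z≤ord) = ≤-trans
      (chainPrimeUpTo-≤-divisorIndex {i} q<p primes (m%n≡0⇒n∣m _ q (trans (chain-% i (2 + r) 1≤p z) uᶻ≡0)))
      z≤ord

chainLength-≤-ordA : ∀ {i p q} → Prime p → InQ i p q → ∀ k → ChainPrimeUpTo i p k → k ≤ ordA i q p
chainLength-≤-ordA {q = 0}           _ (q-prime , _) = contradiction q-prime ¬prime[0]
chainLength-≤-ordA {q = 1}           _ (q-prime , _) = contradiction q-prime ¬prime[1]
chainLength-≤-ordA {q = 2}           _ (_ , q≢2 , _) = contradiction refl q≢2
chainLength-≤-ordA {i} {q = suc (suc (suc r))} p-prime (q-prime , _ , q<p , nonRogue , x≢σ) =
  OddPrime.chainLength-≤-ordA i r q-prime p-prime q<p nonRogue x≢σ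

ordA-<-pred : ∀ {i p q} → 1 ≤ q → q < p → ordA i q p < p ∸ 1
ordA-<-pred {i} {p} {q} 1≤q q<p = ≤-<-trans (m∸n≤m (q ∸ 1) (kIdx i q (modN p q))) (∸-monoˡ-< q<p 1≤q)

mainTheorem5 : (p : ℕ) → Prime p → ¬ (p ≡ 2) → (i : Idx) →
    Σ ℕ (λ q → InQ i p q) →
    ((k : ℕ) → ChainPrimeUpTo i p k → (q : ℕ) → InQ i p q → k ≤ ordA i q p)
    × Σ ℕ (λ q → InQ i p q × ordA i q p < p ∸ 1)
mainTheorem5 p p-prime _ i (q , q∈Q@(q-prime , _ , q<p , _)) =
  (λ k primes _ q′∈Q → chainLength-≤-ordA p-prime q′∈Q k primes) ,
  q , q∈Q , ordA-<-pred (≤-trans (s≤s z≤n) (nonTrivial⇒n>1 q {{prime⇒nonTrivial q-prime}})) q<p
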